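{- Let $a\geq 2$ and $1\leq b<a$ be integers, let $n=2a-b$, and let $\alpha=(1,2,\dots,a)$ and $\beta=(a-b+1,a-b+2,\dots,2a-b)$ be cycles in the symmetric group on $\{1,2,\dots,n\}$. Then the permutation group generated by $\alpha$ and $\beta$ acts 2-transitively on $\{1,2,\dots,n\}$.
   Context: A permutation group $G$ on $\{1,\dots,n\}$ is 2-transitive if for all $x\neq y$ and $w\neq z$ in $\{1,\dots,n\}$ there is $\pi\in G$ with $\pi(x)=w$ and $\pi(y)=z$. A cycle $(s_1,s_2,\dots,s_k)$ maps $s_1\mapsto s_2\mapsto\cdots\mapsto s_k\mapsto s_1$ and fixes all other points. -}

module Defs where

open import Data.Nat using (ℕ; zero; suc; _+_; _*_; _∸_; _≤_; _<_; s≤s; z≤n; _<?_; _≤?_)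
open import Data.Nat.Properties
open import Data.Fin using (Fin; toℕ; fromℕ<)
open import Data.Fin.Properties using (toℕ-fromℕ<; fromℕ<-toℕ; toℕ<n; toℕ-injective)
open import Data.Fin.Permutation using (Permutation′; permutation; _⟨$⟩ʳ_; _∘ₚ_; flip; id)
open import Data.Product using (Σ; ∃; _×_; _,_)
open import Relation.Nullary using (yes; no; ¬_; Dec)
open import Data.Empty using (⊥-elim)
open import Relation.Binary.PropositionalEquality
open import Data.Bool using (Bool; true; false)

-- Points are 0-indexed: the paper's point p ∈ {1,…,n} is Fin n element p-1.
-- rot s k i : the cycle (s, s+1, …, s+k-1) acting on ℕ
--   (s+j ↦ s+j+1 for j+1<k, s+k-1 ↦ s; everything else fixed).

rot : ℕ → ℕ → ℕ → ℕ
rot s k i with i <? s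
... | yes _ = i
... | no _ with suc i <? s + k
...   | yes _ = suc i
...   | no _ with i <? s + k
...     | yes _ = s
...     | no _ = i

rotInv : ℕ → ℕ → ℕ → ℕ
rotInv s k i with i <? s
... | yes _ = i
... | no _ with i <? s + k
...   | no _ = i
...   | yes _ with s <? i
...     | yes _ = i ∸ 1
...     | no _ = s + k ∸ 1

private
  rot-bound : ∀ {n} s k i → s + k ≤ n → i < n → rot s k i < n
  rot-bound s k i h hi with i <? s
  ... | yes _ = hi
  ... | no i≮s with suc i <? s + k
  ...   | yes p = <-≤-trans p h
  ...   | no _ with i <? s + k
  ...     | yes p = ≤-<-trans (≮⇒≥ i≮s) hi
  ...     | no _ = hi

  pred< : ∀ {x y} → x < y → y ∸ 1 < y
  pred< {y = suc y} _ = n<1+n y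

  rotInv-bound : ∀ {n} s k i → s + k ≤ n → i < n → rotInv s k i < n
  rotInv-bound s k i h hi with i <? s
  ... | yes _ = hi
  ... | no _ with i <? s + k
  ...   | no _ = hi
  ...   | yes p with s <? i
  ...     | yes _ = ≤-<-trans (m∸n≤m i 1) hi
  ...     | no _ = <-≤-trans (pred< p) h

  rot-below : ∀ s k i → i < s → rot s k i ≡ i
  rot-below s k i p with i <? s
  ... | yes _ = refl
  ... | no q = ⊥-elim (q p)

  rot-mid : ∀ s k i → s ≤ i → suc i < s + k → rot s k i ≡ suc i
  rot-mid s k i p q with i <? s
  ... | yes r = ⊥-elim (<⇒≱ r p)
  ... | no _ with suc i <? s + k
  ...   | yes _ = refl
  ...   | no r = ⊥-elim (r q)

  rot-last : ∀ s k i → s ≤ i → suc i ≡ s + k → rot s k i ≡ s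
  rot-last s k i p q with i <? s
  ... | yes r = ⊥-elim (<⇒≱ r p)
  ... | no _ with suc i <? s + k
  ...   | yes r = ⊥-elim (<-irrefl q r)
  ...   | no _ with i <? s + k
  ...     | yes _ = refl
  ...     | no r = ⊥-elim (r (≤-reflexive q))

  rot-above : ∀ s k i → s + k ≤ i → rot s k i ≡ i
  rot-above s k i p with i <? s
  ... | yes _ = refl
  ... | no _ with suc i <? s + k
  ...   | yes r = ⊥-elim (<⇒≱ r (≤-trans p (n≤1+n i)))
  ...   | no _ with i <? s + k
  ...     | yes r = ⊥-elim (<⇒≱ r p)
  ...     | no _ = refl

  inv-below : ∀ s k i → i < s → rotInv s k i ≡ i
  inv-below s k i p with i <? s
  ... | yes _ = refl
  ... | no q = ⊥-elim (q p)

  inv-above : ∀ s k i → s + k ≤ i → rotInv s k i ≡ i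
  inv-above s k i p with i <? s
  ... | yes _ = refl
  ... | no _ with i <? s + k
  ...   | no _ = refl
  ...   | yes r = ⊥-elim (<⇒≱ r p)

  inv-mid : ∀ s k i → s < i → i < s + k → rotInv s k i ≡ i ∸ 1
  inv-mid s k i p q with i <? s
  ... | yes r = ⊥-elim (<-asym p r)
  ... | no _ with i <? s + k
  ...   | no r = ⊥-elim (r q)
  ...   | yes _ with s <? i
  ...     | yes _ = refl
  ...     | no r = ⊥-elim (r p)

  inv-first : ∀ s k → 0 < k → rotInv s k s ≡ s + k ∸ 1
  inv-first s k p with s <? s
  ... | yes r = ⊥-elim (<-irrefl refl r)
  ... | no _ with s <? s + k
  ...   | no r = ⊥-elim (r (subst (_< s + k) (+-identityʳ s) (+-monoʳ-< s p)))
  ...   | yes _ with s <? s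
  ...     | yes r = ⊥-elim (<-irrefl refl r)
  ...     | no _ = refl

  pred-suc : ∀ {x y} → x < y → suc (y ∸ 1) ≡ y
  pred-suc {y = suc y} _ = refl

  inv∘rot : ∀ s k i → 0 < k → rotInv s k (rot s k i) ≡ i
  inv∘rot s k i kp = go (i <? s) (suc i <? s + k) (i <? s + k)
    where
    go : Dec (i < s) → Dec (suc i < s + k) → Dec (i < s + k) → rotInv s k (rot s k i) ≡ i
    go (yes p) _ _ = trans (cong (rotInv s k) (rot-below s k i p)) (inv-below s k i p)
    go (no p) (yes q) _ = trans (cong (rotInv s k) (rot-mid s k i (≮⇒≥ p) q))
                        (inv-mid s k (suc i) (s≤s (≮⇒≥ p)) q)
    go (no p) (no q) (yes r) = trans (cong (rotInv s k) (rot-last s k i (≮⇒≥ p) si≡))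
                          (trans (inv-first s k kp) (cong (_∸ 1) (sym si≡)))
      where si≡ = ≤-antisym r (≮⇒≥ q)
    go (no p) (no q) (no r) = trans (cong (rotInv s k) (rot-above s k i (≮⇒≥ r))) (inv-above s k i (≮⇒≥ r))

  rot∘inv : ∀ s k i → 0 < k → rot s k (rotInv s k i) ≡ i
  rot∘inv s k i kp = go (i <? s) (i <? s + k) (s <? i)
    where
    go : Dec (i < s) → Dec (i < s + k) → Dec (s < i) → rot s k (rotInv s k i) ≡ i
    go (yes p) _ _ = trans (cong (rot s k) (inv-below s k i p)) (rot-below s k i p)
    go (no p) (no q) _ = trans (cong (rot s k) (inv-above s k i (≮⇒≥ q))) (rot-above s k i (≮⇒≥ q))
    go (no p) (yes q) (yes r) = trans (cong (rot s k) (inv-mid s k i r q))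
                       (trans (rot-mid s k (i ∸ 1) (≤-pred (subst (s <_) (sym (pred-suc r)) r))
                                 (subst (_< s + k) (sym (pred-suc r)) q))
                              (pred-suc r))
    go (no p) (yes q) (no r) = trans (cong (rot s k) (cong (rotInv s k) i≡s))
                     (trans (cong (rot s k) (inv-first s k kp))
                       (trans (rot-last s k (s + k ∸ 1) le (pred-suc q)) (sym i≡s)))
      where
      i≡s : i ≡ s
      i≡s = ≤-antisym (≮⇒≥ r) (≮⇒≥ p)
      le : s ≤ s + k ∸ 1
      le = ≤-pred (subst (s <_) (sym (pred-suc q)) (subst (_< s + k) i≡s q))

cycle : ∀ {n} (s k : ℕ) → 0 < k → s + k ≤ n → Permutation′ n
cycle {n} s k kp h = permutation f g fg gf
  where
  f : Fin n → Fin n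
  f i = fromℕ< (rot-bound s k (toℕ i) h (toℕ<n i))
  g : Fin n → Fin n
  g i = fromℕ< (rotInv-bound s k (toℕ i) h (toℕ<n i))
  fg : ∀ i → f (g i) ≡ i
  fg i = toℕ-injective (trans (toℕ-fromℕ< _)
           (trans (cong (rot s k) (toℕ-fromℕ< _)) (rot∘inv s k (toℕ i) kp)))
  gf : ∀ i → g (f i) ≡ i
  gf i = toℕ-injective (trans (toℕ-fromℕ< _)
           (trans (cong (rotInv s k) (toℕ-fromℕ< _)) (inv∘rot s k (toℕ i) kp)))

data Generated {n : ℕ} {I : Set} (gen : I → Permutation′ n) : Permutation′ n → Set where
  gen-id  : Generated gen id
  gen-gen : ∀ i → Generated gen (gen i)
  gen-inv : ∀ {π} → Generated gen π → Generated gen (flip π)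
  gen-mul : ∀ {π σ} → Generated gen π → Generated gen σ → Generated gen (π ∘ₚ σ)

TwoTransitive : ∀ {n} → (Permutation′ n → Set) → Set
TwoTransitive {n} G = ∀ (x y w z : Fin n) → x ≢ y → w ≢ z →
  ∃ λ π → G π × (π ⟨$⟩ʳ x ≡ w) × (π ⟨$⟩ʳ y ≡ z)

-- The two cycles of the statement, with n = 2a - b.
-- α = (1,…,a) and β = (a-b+1,…,2a-b) in the paper's 1-indexed notation,
-- i.e. the blocks starting at 0 and at a-b (0-indexed), both of length a.

module _ (a b : ℕ) (a≥2 : 2 ≤ a) (b<a : b < a) where

  private
    0<a : 0 < a
    0<a = ≤-trans (s≤s z≤n) a≥2
    eqn : (a ∸ b) + a ≡ 2 * a ∸ b
    eqn = trans (+-comm (a ∸ b) a)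
            (trans (sym (+-∸-assoc a (<⇒≤ b<a)))
              (cong (_∸ b) (cong (a +_) (sym (+-identityʳ a)))))

  -- α for true, β for false
  αβ-gens : Bool → Permutation′ (2 * a ∸ b)
  αβ-gens true  = cycle 0 a 0<a (≤-trans (m≤n+m a (a ∸ b)) (≤-reflexive eqn))
  αβ-gens false = cycle (a ∸ b) a 0<a (≤-reflexive eqn)

module Submission where

-- Number the points 0, …, N with N = n - 1, let α rotate the block [0, a) and β the
-- block [c, N], where c = a - b, so 1 ≤ c < a. Together α and β move any point
-- step by step up to N, so the group is transitive, and 2-transitivity follows once
-- every pair (N, q) with q < N can be brought to (N, 0). For q < a, α fixes N and rotates q round
-- to 0. For a ≤ q < N, write s = N - q: the pair (N, q) = (q + s, q) comes from
-- (a - 1 + s, a - 1) by shifting both points up with β, α sends (a - 1 + s, a - 1)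
-- to (a - 1 + s, 0), and β, which fixes 0, shifts a - 1 + s back up to N.

open import Defs
open import Data.Nat using (ℕ; suc; _+_; _*_; _∸_; _≤_; _<_; _≤′_; ≤′-refl; ≤′-step; s≤s; z≤n; _<?_; _≤?_)
open import Data.Nat.Properties
open import Data.Fin using (Fin; toℕ; fromℕ<)
open import Data.Fin.Properties using (toℕ-fromℕ<; toℕ<n; toℕ-injective)
open import Data.Fin.Permutation using (Permutation′; _⟨$⟩ʳ_; _∘ₚ_; flip; id; inverseˡ)
open import Data.Product using (∃; _×_; _,_)
open import Function.Bundles using (Injection)
open import Function.Properties.Inverse using (↔⇒↣)
open import Relation.Nullary using (Dec; yes; no)
open import Data.Empty using (⊥-elim)
open import Data.Bool using (true; false)
open import Relation.Binary.PropositionalEquality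

descend : ∀ (P : ℕ → Set) {m n} → P n → (∀ {k} → m ≤ k → k < n → P (suc k) → P k) → m ≤ n → P m
descend P {m} Pn step m≤n = go (≤⇒≤′ m≤n) Pn step
  where
  go : ∀ {n} → m ≤′ n → P n → (∀ {k} → m ≤ k → k < n → P (suc k) → P k) → P m
  go ≤′-refl        Pn step = Pn
  go (≤′-step m≤′n) Pn step =
    go m≤′n (step (≤′⇒≤ m≤′n) ≤-refl Pn) (λ m≤k k<n → step m≤k (m<n⇒m<1+n k<n))

ascend : ∀ (P : ℕ → Set) {m n} → P m → (∀ {k} → m ≤ k → k < n → P k → P (suc k)) → m ≤ n → P n
ascend P {m} Pm step m≤n = go (≤⇒≤′ m≤n) step
  where
  go : ∀ {n} → m ≤′ n → (∀ {k} → m ≤ k → k < n → P k → P (suc k)) → P n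
  go ≤′-refl        step = Pm
  go (≤′-step m≤′n) step =
    step (≤′⇒≤ m≤′n) ≤-refl (go m≤′n (λ m≤k k<n → step m≤k (m<n⇒m<1+n k<n)))

rot-below : ∀ s k i → i < s → rot s k i ≡ i
rot-below s k i i<s with i <? s
... | yes _ = refl
... | no i≮s = ⊥-elim (i≮s i<s)

rot-suc : ∀ s k i → s ≤ i → suc i < s + k → rot s k i ≡ suc i
rot-suc s k i s≤i i<last with i <? s
... | yes i<s = ⊥-elim (<⇒≱ i<s s≤i)
... | no _ with suc i <? s + k
...   | yes _ = refl
...   | no i≮last = ⊥-elim (i≮last i<last)

rot-last : ∀ s k i → s ≤ i → suc i ≡ s + k → rot s k i ≡ s
rot-last s k i s≤i i≡last with i <? s
... | yes i<s = ⊥-elim (<⇒≱ i<s s≤i)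
... | no _ with suc i <? s + k
...   | yes i<last = ⊥-elim (<-irrefl i≡last i<last)
...   | no _ with i <? s + k
...     | yes _ = refl
...     | no i≮end = ⊥-elim (i≮end (≤-reflexive i≡last))

rot-above : ∀ s k i → s + k ≤ i → rot s k i ≡ i
rot-above s k i end≤i with i <? s
... | yes _ = refl
... | no _ with suc i <? s + k
...   | yes i<last = ⊥-elim (<⇒≱ i<last (m≤n⇒m≤1+n end≤i))
...   | no _ with i <? s + k
...     | yes i<end = ⊥-elim (<⇒≱ i<end end≤i)
...     | no _ = refl

toℕ≡⇒≡fromℕ< : ∀ {n p} {x : Fin n} (p<n : p < n) → toℕ x ≡ p → x ≡ fromℕ< p<n
toℕ≡⇒≡fromℕ< p<n x≡p = toℕ-injective (trans x≡p (sym (toℕ-fromℕ< p<n)))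

module Orbits {n : ℕ} {I : Set} (gen : I → Permutation′ n) where

  infix 4 _~_
  _~_ : Fin n × Fin n → Fin n × Fin n → Set
  (x , y) ~ (w , z) = ∃ λ π → Generated gen π × π ⟨$⟩ʳ x ≡ w × π ⟨$⟩ʳ y ≡ z

  ~-apply : ∀ {π} → Generated gen π → ∀ x y → (x , y) ~ (π ⟨$⟩ʳ x , π ⟨$⟩ʳ y)
  ~-apply {π} gπ x y = π , gπ , refl , refl

  ~-sym : ∀ {x y w z} → (x , y) ~ (w , z) → (w , z) ~ (x , y)
  ~-sym (π , gπ , refl , refl) = flip π , gen-inv gπ , inverseˡ π , inverseˡ π

  ~-trans : ∀ {x y u v w z} → (x , y) ~ (u , v) → (u , v) ~ (w , z) → (x , y) ~ (w , z)
  ~-trans (π , gπ , refl , refl) (σ , gσ , refl , refl) = π ∘ₚ σ , gen-mul gπ gσ , refl , refl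

  stabilizer-transitive⇒2-transitive : ∀ u v →
    (∀ x → ∃ λ π → Generated gen π × π ⟨$⟩ʳ x ≡ u) →
    (∀ y → y ≢ u → (u , y) ~ (u , v)) →
    TwoTransitive (Generated gen)
  stabilizer-transitive⇒2-transitive u v transitive stabilizer x y w z x≢y w≢z =
    ~-trans (toBase x y x≢y) (~-sym (toBase w z w≢z))
    where
    toBase : ∀ x y → x ≢ y → (x , y) ~ (u , v)
    toBase x y x≢y with transitive x
    ... | π , gπ , refl = ~-trans (~-apply gπ x y)
          (stabilizer (π ⟨$⟩ʳ y) (λ πy≡πx → x≢y (sym (Injection.injective (↔⇒↣ π) πy≡πx))))

  Reaches : Fin n × Fin n → ℕ → ℕ → Set
  Reaches t p q = ∀ x y → toℕ x ≡ p → toℕ y ≡ q → (x , y) ~ t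

  module _ {π : Permutation′ n} (gπ : Generated gen π) {r : ℕ → ℕ}
           (action : ∀ x → toℕ (π ⟨$⟩ʳ x) ≡ r (toℕ x)) {t : Fin n × Fin n} where

    reaches-pull : ∀ {p q p′ q′} → r p ≡ p′ → r q ≡ q′ → Reaches t p′ q′ → Reaches t p q
    reaches-pull rp≡ rq≡ h x y refl refl =
      ~-trans (~-apply gπ x y) (h _ _ (trans (action x) rp≡) (trans (action y) rq≡))

    reaches-push : ∀ {p q p′ q′} → p < n → q < n → r p ≡ p′ → r q ≡ q′ →
                   Reaches t p q → Reaches t p′ q′
    reaches-push p<n q<n rp≡ rq≡ h x y refl refl =
      ~-trans (~-sym (subst₂ (λ u v → (fromℕ< p<n , fromℕ< q<n) ~ (u , v))
                        (image p<n rp≡) (image q<n rq≡) (~-apply gπ _ _)))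
              (h _ _ (toℕ-fromℕ< p<n) (toℕ-fromℕ< q<n))
      where
      image : ∀ {p} (p<n : p < n) {z} → r p ≡ toℕ z → π ⟨$⟩ʳ fromℕ< p<n ≡ z
      image p<n rp≡z = toℕ-injective (trans (action _) (trans (cong r (toℕ-fromℕ< p<n)) rp≡z))

module TwoCycles {n : ℕ} {I : Set} (gen : I → Permutation′ n)
  (c a₁ : ℕ) (1≤c : 1 ≤ c) (c<a : c < suc a₁) (n≡ : c + suc a₁ ≡ n)
  (iα iβ : I)
  (α-action : ∀ x → toℕ (gen iα ⟨$⟩ʳ x) ≡ rot 0 (suc a₁) (toℕ x))
  (β-action : ∀ x → toℕ (gen iβ ⟨$⟩ʳ x) ≡ rot c (suc a₁) (toℕ x)) where

  open Orbits gen

  a N : ℕ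
  a = suc a₁
  N = c + a₁

  1+N≡n : suc N ≡ n
  1+N≡n = trans (sym (+-suc c a₁)) n≡

  N<n : N < n
  N<n = ≤-reflexive 1+N≡n

  ≤N : ∀ x → toℕ x ≤ N
  ≤N x = ≤-pred (subst (toℕ x <_) (sym 1+N≡n) (toℕ<n x))

  c≤a₁ : c ≤ a₁
  c≤a₁ = ≤-pred c<a

  <N⇒<n : ∀ {i} → i < N → i < n
  <N⇒<n i<N = <-trans i<N N<n

  a≤N : a ≤ N
  a≤N = +-monoˡ-≤ a₁ 1≤c

  0<n : 0 < n
  0<n = ≤-<-trans z≤n N<n

  top bottom : Fin n
  top    = fromℕ< N<n
  bottom = fromℕ< 0<n

  α-suc : ∀ {i} → suc i < a → rot 0 a i ≡ suc i
  α-suc = rot-suc 0 a _ z≤n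

  α-last : rot 0 a a₁ ≡ 0
  α-last = rot-last 0 a a₁ z≤n refl

  α-fixes : ∀ {i} → a ≤ i → rot 0 a i ≡ i
  α-fixes = rot-above 0 a _

  β-suc : ∀ {i} → c ≤ i → i < N → rot c a i ≡ suc i
  β-suc {i} c≤i i<N = rot-suc c a i c≤i (subst (suc i <_) (sym (+-suc c a₁)) (s≤s i<N))

  β-fixes-0 : rot c a 0 ≡ 0
  β-fixes-0 = rot-below c a 0 1≤c

  MovesToTop : Fin n → Set
  MovesToTop x = ∃ λ π → Generated gen π × π ⟨$⟩ʳ x ≡ top

  moves-to-top : ∀ {p} → p ≤ N → ∀ x → toℕ x ≡ p → MovesToTop x
  moves-to-top = descend (λ p → ∀ x → toℕ x ≡ p → MovesToTop x)
    (λ x x≡N → id , gen-id , toℕ≡⇒≡fromℕ< N<n x≡N)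
    climb
    where
    climb : ∀ {m k} → m ≤ k → k < N → (∀ x → toℕ x ≡ suc k → MovesToTop x) →
            ∀ x → toℕ x ≡ k → MovesToTop x
    climb {k = k} _ k<N up x x≡k = by (k <? c)
      where
      via : ∀ i → toℕ (gen i ⟨$⟩ʳ x) ≡ suc k → MovesToTop x
      via i moves with up _ moves
      ... | σ , gσ , σ↦top = gen i ∘ₚ σ , gen-mul (gen-gen i) gσ , σ↦top
      by : Dec (k < c) → MovesToTop x
      by (yes k<c) = via iα (trans (α-action x) (trans (cong (rot 0 a) x≡k) (α-suc (<-≤-trans (s≤s k<c) c<a))))
      by (no k≮c)  = via iβ (trans (β-action x) (trans (cong (rot c a) x≡k) (β-suc (≮⇒≥ k≮c) k<N)))

  R : ℕ → ℕ → Set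
  R = Reaches (top , bottom)

  pull-α : ∀ {p q p′ q′} → rot 0 a p ≡ p′ → rot 0 a q ≡ q′ → R p′ q′ → R p q
  pull-α = reaches-pull (gen-gen iα) α-action

  pull-β : ∀ {p q p′ q′} → rot c a p ≡ p′ → rot c a q ≡ q′ → R p′ q′ → R p q
  pull-β = reaches-pull (gen-gen iβ) β-action

  push-β : ∀ {p q p′ q′} → p < n → q < n → rot c a p ≡ p′ → rot c a q ≡ q′ → R p q → R p′ q′
  push-β = reaches-push (gen-gen iβ) β-action

  reaches-target : R N 0
  reaches-target x y x≡N y≡0 = id , gen-id , toℕ≡⇒≡fromℕ< N<n x≡N , toℕ≡⇒≡fromℕ< 0<n y≡0

  reaches-with-0 : ∀ {m} → a ≤ m → m ≤ N → R m 0
  reaches-with-0 a≤m = descend (λ m → R m 0) reaches-target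
    (λ m≤k k<N → pull-β (β-suc (≤-trans (<⇒≤ c<a) (≤-trans a≤m m≤k)) k<N) β-fixes-0)

  reaches-with-a₁ : ∀ {p} → a ≤ p → p ≤ N → R p a₁
  reaches-with-a₁ a≤p p≤N = pull-α (α-fixes a≤p) α-last (reaches-with-0 a≤p p≤N)

  reaches-low : ∀ {q} → q ≤ a₁ → R N q
  reaches-low = descend (R N) (reaches-with-a₁ a≤N ≤-refl)
    (λ _ k<a₁ → pull-α (α-fixes a≤N) (α-suc (s≤s k<a₁)))

  reaches-high : ∀ {q} → a₁ ≤ q → q < N → R N q
  reaches-high {q} a₁≤q q<N =
    subst (λ p → R p q) q+s≡N (ascend (λ i → R (i + s) i) (reaches-with-a₁ a≤a₁+s a₁+s≤N) shift a₁≤q)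
    where
    s : ℕ
    s = N ∸ q
    q+s≡N : q + s ≡ N
    q+s≡N = m+[n∸m]≡n (<⇒≤ q<N)
    a≤a₁+s : a ≤ a₁ + s
    a≤a₁+s = subst (_≤ a₁ + s) (+-comm a₁ 1) (+-monoʳ-≤ a₁ (m<n⇒0<n∸m q<N))
    a₁+s≤N : a₁ + s ≤ N
    a₁+s≤N = subst (a₁ + s ≤_) q+s≡N (+-monoˡ-≤ s a₁≤q)
    shift : ∀ {i} → a₁ ≤ i → i < q → R (i + s) i → R (suc i + s) (suc i)
    shift {i} a₁≤i i<q = push-β (<N⇒<n i+s<N) (<N⇒<n i<N)
        (β-suc (≤-trans c≤i (m≤m+n i s)) i+s<N) (β-suc c≤i i<N)
      where
      c≤i : c ≤ i
      c≤i = ≤-trans c≤a₁ a₁≤i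
      i<N : i < N
      i<N = <-trans i<q q<N
      i+s<N : i + s < N
      i+s<N = subst (i + s <_) q+s≡N (+-monoˡ-< s i<q)

  reaches : ∀ {q} → q < N → R N q
  reaches {q} q<N with q ≤? a₁
  ... | yes q≤a₁ = reaches-low q≤a₁
  ... | no q≰a₁  = reaches-high (<⇒≤ (≰⇒> q≰a₁)) q<N

  stabilizer : ∀ y → y ≢ top → (top , y) ~ (top , bottom)
  stabilizer y y≢top = reaches y<N top y (toℕ-fromℕ< N<n) refl
    where
    y<N : toℕ y < N
    y<N = ≤∧≢⇒< (≤N y) (λ y≡N → y≢top (toℕ≡⇒≡fromℕ< N<n y≡N))

  twoTransitive : TwoTransitive (Generated gen)
  twoTransitive = stabilizer-transitive⇒2-transitive top bottom (λ x → moves-to-top (≤N x) x refl) stabilizer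

m∸n+m≡2*m∸n : ∀ m {n} → n ≤ m → m ∸ n + m ≡ 2 * m ∸ n
m∸n+m≡2*m∸n m {n} n≤m = begin
  m ∸ n + m        ≡⟨ +-comm (m ∸ n) m ⟩
  m + (m ∸ n)      ≡⟨ +-∸-assoc m n≤m ⟨
  m + m ∸ n        ≡⟨ cong (λ k → m + k ∸ n) (+-identityʳ m) ⟨
  2 * m ∸ n        ∎
  where open ≡-Reasoning

lemma4 : (a b : ℕ) (a≥2 : 2 ≤ a) (1≤b : 1 ≤ b) (b<a : b < a) →
    TwoTransitive (Generated (αβ-gens a b a≥2 b<a))
lemma4 (suc a₁) b a≥2 1≤b b<a =
  TwoCycles.twoTransitive (αβ-gens (suc a₁) b a≥2 b<a)
    (suc a₁ ∸ b) a₁ (m<n⇒0<n∸m b<a) (∸-monoʳ-< 1≤b (<⇒≤ b<a)) (m∸n+m≡2*m∸n (suc a₁) (<⇒≤ b<a))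
    true false (λ _ → toℕ-fromℕ< _) (λ _ → toℕ-fromℕ< _)
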